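{- Let $\pi\in S_n$ be an involution. Then $$\mathfrak A(\pi)=\mathfrak I(\pi)+\sum_{a\,:\,\pi(a)=a}(n-a).$$
   Context: Identify the involution $\pi$ with the anti-symmetric monomial $n\times n$ matrix $M_\pi$ having entry $1$ at $(i,j)$ and $-1$ at $(j,i)$ for every transposition $(i,j)$, $i<j$, of $\pi$, and zeros elsewhere. Let $R(M_\pi)=(r_{ij})$ be its rank-control matrix, $r_{ij}$ being the rank of the upper-left $i\times j$ submatrix of $M_\pi$, and set $r_{0k}=0$ for $0\le k<n$; define $\mathfrak A(\pi)=\#\{(i,j):1\le i<j\le n,\ r_{ij}=r_{i-1,j-1}\}$. Write $\pi$ in canonic form $\pi=(i_1,j_1)(i_2,j_2)\cdots(i_k,j_k)$ as a product of disjoint transpositions with $i_t<j_t$ for all $t$ and $i_1<i_2<\cdots<i_k$; $\mathfrak I(\pi)$ is the number of inversions of the word $i_1j_1i_2j_2\cdots i_kj_k$ (pairs of positions $p<q$ whose letters satisfy letter at $p$ > letter at $q$). -}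

module Defs where

open import Data.Nat as ℕ using (ℕ; zero; suc; _∸_; _<?_; _≟_)
open import Data.Nat.Properties using (<-cmp)
open import Data.Integer as ℤ using (ℤ; +_; -_)
open import Data.Fin as Fin using (Fin; toℕ; fromℕ<; punchIn)
open import Data.Vec as Vec using (Vec; []; _∷_; lookup)
open import Data.List as List using (List; []; _∷_; _++_; [_]; allFin; upTo; filter; length; concatMap; foldr)
open import Data.Bool.ListAction using (any)
open import Relation.Nullary using (yes; no; Dec)
open import Relation.Nullary.Decidable using (_×-dec_)
open import Data.Product using (_×_; _,_; proj₁; proj₂)
open import Data.Nat.ListAction using (sum)
open import Relation.Binary.PropositionalEquality using (_≡_)
open import Data.Bool using (Bool; true; false; if_then_else_)
open import Relation.Nullary.Decidable using (does; ⌊_⌋)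
open import Relation.Binary.Definitions using (tri<; tri≈; tri>)

-- Generic linear algebra over ℤ: determinant (Laplace expansion along
-- the first row) and determinantal rank (largest k with a nonzero k×k
-- minor).  For integer matrices this is the rank over ℚ.

alt : ℕ → ℤ
alt zero    = + 1
alt (suc k) = - alt k

sumℤ : List ℤ → ℤ
sumℤ = foldr ℤ._+_ (+ 0)

det : ∀ {k} → (Fin k → Fin k → ℤ) → ℤ
det {zero}  A = + 1
det {suc k} A =
  sumℤ (List.map (λ j → alt (toℕ j) ℤ.* (A Fin.zero j ℤ.* det (λ a b → A (Fin.suc a) (punchIn j b))))
                 (allFin (suc k)))

-- all strictly increasing sequences of length k in Fin m (= k-subsets)
choose : (m k : ℕ) → List (Vec (Fin m) k)
choose m       zero    = [ [] ]
choose zero    (suc k) = []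
choose (suc m) (suc k) =
  List.map (λ v → Fin.zero ∷ Vec.map Fin.suc v) (choose m k)
  ++ List.map (Vec.map Fin.suc) (choose m (suc k))

nonzero : ℤ → Bool
nonzero z = if ⌊ z ℤ.≟ + 0 ⌋ then false else true

hasMinor : ∀ {m p} → (Fin m → Fin p → ℤ) → ℕ → Bool
hasMinor {m} {p} A k =
  any (λ rs → any (λ cs → nonzero (det (λ a b → A (lookup rs a) (lookup cs b)))) (choose p k)) (choose m k)

rankFrom : ∀ {m p} → (Fin m → Fin p → ℤ) → ℕ → ℕ
rankFrom A zero    = 0
rankFrom A (suc k) = if hasMinor A (suc k) then suc k else rankFrom A k

rank : ∀ {m p} → (Fin m → Fin p → ℤ) → ℕ
rank {m} A = rankFrom A m

-- Involutions and the matrix M_π (0-based indices internally)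

IsInvolution : ∀ {n} → (Fin n → Fin n) → Set
IsInvolution π = ∀ i → π (π i) ≡ i

Mπ : ∀ {n} → (Fin n → Fin n) → Fin n → Fin n → ℤ
Mπ π i j with does (toℕ (π i) ≟ toℕ j)
... | false = + 0
... | true with <-cmp (toℕ i) (toℕ j)
...   | tri< _ _ _ = + 1
...   | tri≈ _ _ _ = + 0
...   | tri> _ _ _ = - (+ 1)

Mext : ∀ {n} → (Fin n → Fin n) → ℕ → ℕ → ℤ
Mext {n} π a b with a <? n | b <? n
... | yes p | yes q = Mπ π (fromℕ< p) (fromℕ< q)
... | _ | _ = + 0

-- r i j = rank of the upper-left i×j submatrix of M_π (meaningful for
-- 0 ≤ i,j ≤ n); in particular r 0 k = 0.
rankControl : ∀ {n} → (Fin n → Fin n) → ℕ → ℕ → ℕ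
rankControl π i j = rank {i} {j} (λ a b → Mext π (toℕ a) (toℕ b))

𝔄 : ∀ {n} → (Fin n → Fin n) → ℕ
𝔄 {n} π = length (filter P pairs)
  where
    r = rankControl π
    idx = List.map suc (upTo n)
    pairs = concatMap (λ i → List.map (λ j → (i , j)) idx) idx
    P : (p : ℕ × ℕ) → Dec ((proj₁ p ℕ.< proj₂ p) × (r (proj₁ p) (proj₂ p) ≡ r (proj₁ p ∸ 1) (proj₂ p ∸ 1)))
    P (i , j) = (i <? j) ×-dec (r i j ≟ r (i ∸ 1) (j ∸ 1))

-- canonic-form word i₁ j₁ i₂ j₂ ... i_k j_k (0-based letters; inversions
-- are invariant under the shift to 1-based letters)
canonicWord : ∀ {n} → (Fin n → Fin n) → List ℕ
canonicWord {n} π =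
  concatMap (λ i → toℕ i ∷ toℕ (π i) ∷ [])
            (filter (λ i → toℕ i <? toℕ (π i)) (allFin n))

inversions : List ℕ → ℕ
inversions []       = 0
inversions (x ∷ xs) = length (filter (λ y → y <? x) xs) ℕ.+ inversions xs

𝔍 : ∀ {n} → (Fin n → Fin n) → ℕ
𝔍 π = inversions (canonicWord π)

-- Σ_{a : π(a)=a} (n - a), with a 1-based (a = toℕ a' + 1)
fixedSum : ∀ {n} → (Fin n → Fin n) → ℕ
fixedSum {n} π =
  sum (List.map (λ a → n ∸ suc (toℕ a)) (filter (λ a → toℕ (π a) ≟ toℕ a) (allFin n)))

module Submission where

-- Let p be the involution of ℕ extending π by the identity; x is live when p x ≠ x, and the
-- transpositions of π are the arcs (a, p a) with a < p a.
--  1. Rank.  The upper-left i×j corner of M_π is a signed partial permutation matrix, so its rank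
--     is the number r(i,j) = #{x < i : p x < j, x live} of its nonzero entries: the rows and
--     columns carrying those entries give a unit monomial minor, and any larger minor has a zero
--     row.  Double counting along the involution shows r(i,j) = r(j,i).
--  2. Rank increments.  By this symmetry r(a+1,b+1) = r(a,b) + [p b < a, b live] + [p a ≤ b, a live],
--     so 𝔄(π) counts the pairs a < b for which both brackets vanish.
--  3. Arcs.  A case analysis of such pairs, followed by reindexing two of the resulting families
--     along the involution, gives 𝔄(π) = #{a < b : a fixed} + #crossing + #nested pairs of arcs.
--  4. The word.  The inversions of the canonic word count exactly the crossing and the nested pairs
--     of arcs, and #{a < b : a fixed} is the fixed-point sum.

open import Defs
open import Data.Nat
  using (ℕ; zero; suc; _+_; _*_; _∸_; _<_; _≤_; _<ᵇ_; _≡ᵇ_; z≤n; s≤s; s<s; _<?_; _≟_)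
open import Data.Nat.Properties
  using ( +-identityʳ; +-assoc; +-comm; +-cancelʳ-≡; +-mono-≤; *-identityˡ; ≤-refl; ≤-trans; ≤-reflexive
        ; <-trans; <-irrefl; <⇒≤; <⇒≢; >⇒≢; <⇒≱; ≤⇒≯; n<1+n; n≤1+n; m≤m+n; m≤n⇒m<n∨m≡n; <-cmp
        ; <ᵇ⇒<; ≡ᵇ⇒≡; +-0-commutativeMonoid)
open import Data.Bool using (Bool; true; false; _∧_; not; T)
open import Data.Bool.Properties using (∧-identityʳ; ∧-zeroʳ)
open import Data.Fin as Fin using (Fin; toℕ; fromℕ<; punchIn; punchOut)
open import Data.Fin.Properties
  using (toℕ<n; toℕ-fromℕ<; fromℕ<-toℕ; toℕ-injective; toℕ-inject₁; toℕ-fromℕ; suc-injective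
        ; punchIn-injective; punchOut-injective; punchIn-punchOut; injective⇒≤; ¬∀⟶∃¬)
open import Data.Vec as Vec using (Vec; []; _∷_; lookup)
open import Data.Vec.Properties using (lookup-map)
open import Data.List
  using (List; []; _∷_; _++_; map; filter; length; concatMap; applyUpTo; upTo; tabulate; allFin)
open import Data.List.Properties using (map-tabulate; map-upTo; map-++; map-cong; map-∘)
open import Data.List.Membership.Propositional using (_∈_; find; lose)
open import Data.List.Membership.Propositional.Properties using (∈-map⁺; ∈-map⁻; ∈-++⁺ˡ; ∈-++⁺ʳ; ∈-++⁻)
open import Data.List.Relation.Unary.Any using (here)
open import Data.List.Relation.Unary.Any.Properties using (any⁺; any⁻)
open import Data.Nat.ListAction using (sum)
open import Data.Nat.ListAction.Properties using (sum-++)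
open import Data.Nat.Tactic.RingSolver using (solve-∀)
open import Data.Integer as ℤ using (ℤ; 0ℤ; 1ℤ; -1ℤ; -_)
import Data.Integer.Properties as ℤ
open import Data.Product using (∃; _×_; _,_; proj₁; proj₂)
open import Data.Sum using (_⊎_; inj₁; inj₂)
open import Data.Empty using (⊥-elim)
open import Data.Unit using (tt)
open import Function using (_∘_)
open import Function.Definitions using (Injective)
open import Relation.Binary.PropositionalEquality
open import Relation.Binary.Definitions using (tri<; tri≈; tri>)
open import Relation.Nullary using (¬_; yes; no; Dec; does)
open import Relation.Nullary.Decidable using (dec-true; dec-false; _×-dec_)
import Algebra.Properties.CommutativeMonoid.Sum +-0-commutativeMonoid as FinSum

𝟙 : Bool → ℕ
𝟙 true  = 1
𝟙 false = 0

𝟙-∧ : ∀ a b → 𝟙 (a ∧ b) ≡ 𝟙 a * 𝟙 b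
𝟙-∧ true  b = sym (+-identityʳ (𝟙 b))
𝟙-∧ false b = refl

𝟙≤1 : ∀ b → 𝟙 b ≤ 1
𝟙≤1 true  = s≤s z≤n
𝟙≤1 false = z≤n

T⇒≡true : ∀ {b} → T b → b ≡ true
T⇒≡true {true} _ = refl

¬T⇒≡false : ∀ {b} → ¬ T b → b ≡ false
¬T⇒≡false {false} _  = refl
¬T⇒≡false {true}  ¬t = ⊥-elim (¬t tt)

<ᵇ-true : ∀ {x y} → x < y → (x <ᵇ y) ≡ true
<ᵇ-true {x} {y} = dec-true (x <? y)

<ᵇ-false : ∀ {x y} → y ≤ x → (x <ᵇ y) ≡ false
<ᵇ-false {x} {y} y≤x = dec-false (x <? y) (≤⇒≯ y≤x)

≡ᵇ-refl : ∀ x → (x ≡ᵇ x) ≡ true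
≡ᵇ-refl x = dec-true (x ≟ x) refl

≡ᵇ-false : ∀ {x y} → x ≢ y → (x ≡ᵇ y) ≡ false
≡ᵇ-false {x} {y} = dec-false (x ≟ y)

<ᵇ-true⁻¹ : ∀ x y → (x <ᵇ y) ≡ true → x < y
<ᵇ-true⁻¹ x y e = <ᵇ⇒< x y (subst T (sym e) tt)

≡ᵇ-false⁻¹ : ∀ {x y} → (x ≡ᵇ y) ≡ false → x ≢ y
≡ᵇ-false⁻¹ {x} {y} x≢ᵇy x≡y with () ← trans (sym (dec-true (x ≟ y) x≡y)) x≢ᵇy

≡ᵇ-true⁻¹ : ∀ {x y} → (x ≡ᵇ y) ≡ true → x ≡ y
≡ᵇ-true⁻¹ {x} {y} e = ≡ᵇ⇒≡ x y (subst T (sym e) tt)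

≡ᵇ-sym : ∀ x y → (x ≡ᵇ y) ≡ (y ≡ᵇ x)
≡ᵇ-sym zero    zero    = refl
≡ᵇ-sym zero    (suc y) = refl
≡ᵇ-sym (suc x) zero    = refl
≡ᵇ-sym (suc x) (suc y) = ≡ᵇ-sym x y

+-≡ᵇ-self : ∀ m k → ((m + k) ≡ᵇ m) ≡ (k ≡ᵇ 0)
+-≡ᵇ-self zero    k = refl
+-≡ᵇ-self (suc m) k = +-≡ᵇ-self m k

𝟙+𝟙-≡ᵇ-0 : ∀ u v → ((𝟙 u + 𝟙 v) ≡ᵇ 0) ≡ not u ∧ not v
𝟙+𝟙-≡ᵇ-0 true  v     = refl
𝟙+𝟙-≡ᵇ-0 false true  = refl
𝟙+𝟙-≡ᵇ-0 false false = refl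

-- ∑< n f = f 0 + f 1 + … + f (n − 1), the library's sum over Fin n read through toℕ.  It unfolds
-- definitionally as ∑< (suc n) f = f 0 + ∑< n (f ∘ suc).
∑< : ℕ → (ℕ → ℕ) → ℕ
∑< n f = FinSum.sum {n} (λ i → f (toℕ i))

∑<-cong : ∀ n {f g : ℕ → ℕ} → (∀ x → x < n → f x ≡ g x) → ∑< n f ≡ ∑< n g
∑<-cong n f≗g = FinSum.sum-cong-≗ {n} (λ i → f≗g (toℕ i) (toℕ<n i))

∑<-+ : ∀ n (f g : ℕ → ℕ) → ∑< n (λ x → f x + g x) ≡ ∑< n f + ∑< n g
∑<-+ n f g = FinSum.∑-distrib-+ {n} (λ i → f (toℕ i)) (λ i → g (toℕ i))

∑<-comm : ∀ m n (f : ℕ → ℕ → ℕ) → ∑< m (λ x → ∑< n (f x)) ≡ ∑< n (λ y → ∑< m (λ x → f x y))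
∑<-comm m n f = FinSum.∑-comm {m} {n} (λ i j → f (toℕ i) (toℕ j))

∑<-zero : ∀ n → ∑< n (λ _ → 0) ≡ 0
∑<-zero n = FinSum.sum-replicate-zero n

∑<-last : ∀ n (f : ℕ → ℕ) → ∑< (suc n) f ≡ ∑< n f + f n
∑<-last n f = trans (FinSum.sum-init-last {n} (λ i → f (toℕ i)))
                    (cong₂ _+_ (FinSum.sum-cong-≗ {n} (λ i → cong f (toℕ-inject₁ i))) (cong f (toℕ-fromℕ n)))

∑<-delta : ∀ n t (h : ℕ → ℕ) → ∑< n (λ x → 𝟙 (x ≡ᵇ t) * h x) ≡ 𝟙 (t <ᵇ n) * h t
∑<-delta zero    t       h = refl
∑<-delta (suc n) zero    h = trans (cong (λ s → h 0 + 0 + s) (∑<-zero n)) (+-identityʳ (h 0 + 0))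
∑<-delta (suc n) (suc t) h = ∑<-delta n t (h ∘ suc)

∑<-above : ∀ n a → ∑< n (λ y → 𝟙 (a <ᵇ y)) ≡ n ∸ suc a
∑<-above zero    a       = refl
∑<-above (suc n) zero    = count-all n
  where count-all : ∀ n → ∑< n (λ _ → 1) ≡ n
        count-all zero    = refl
        count-all (suc n) = cong suc (count-all n)
∑<-above (suc n) (suc a) = ∑<-above n a

-- Double counting along an involution p of ℕ: the pairs (x, p x) may be enumerated by either end.

module InvolutionSums (p : ℕ → ℕ) (p-inv : ∀ x → p (p x) ≡ x) where

  -- y = p x  iff  x = p y.
  delta-flip : ∀ (g : ℕ → ℕ) x y → 𝟙 (y ≡ᵇ p x) * g x ≡ 𝟙 (x ≡ᵇ p y) * g (p y)
  delta-flip g x y with y ≟ p x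
  ... | yes refl rewrite p-inv x | ≡ᵇ-refl (p x) | ≡ᵇ-refl x = refl
  ... | no y≢px rewrite ≡ᵇ-false y≢px
                     | ≡ᵇ-false {x} {p y} (λ x≡py → y≢px (trans (sym (p-inv y)) (cong p (sym x≡py)))) = refl

  ∑<-involution : ∀ i j (g : ℕ → ℕ) →
    ∑< i (λ x → 𝟙 (p x <ᵇ j) * g x) ≡ ∑< j (λ y → 𝟙 (p y <ᵇ i) * g (p y))
  ∑<-involution i j g = begin
    ∑< i (λ x → 𝟙 (p x <ᵇ j) * g x)
      ≡⟨ ∑<-cong i (λ x _ → sym (∑<-delta j (p x) (λ _ → g x))) ⟩
    ∑< i (λ x → ∑< j (λ y → 𝟙 (y ≡ᵇ p x) * g x))
      ≡⟨ ∑<-comm i j (λ x y → 𝟙 (y ≡ᵇ p x) * g x) ⟩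
    ∑< j (λ y → ∑< i (λ x → 𝟙 (y ≡ᵇ p x) * g x))
      ≡⟨ ∑<-cong j (λ y _ → ∑<-cong i (λ x _ → delta-flip g x y)) ⟩
    ∑< j (λ y → ∑< i (λ x → 𝟙 (x ≡ᵇ p y) * g (p y)))
      ≡⟨ ∑<-cong j (λ y _ → ∑<-delta i (p y) (λ _ → g (p y))) ⟩
    ∑< j (λ y → 𝟙 (p y <ᵇ i) * g (p y)) ∎
    where open ≡-Reasoning

  ∑<-reindex : ∀ n → (∀ x → x < n → p x < n) → (g : ℕ → ℕ) → ∑< n g ≡ ∑< n (g ∘ p)
  ∑<-reindex n p-bound g = begin
    ∑< n g                               ≡⟨ ∑<-cong n (λ x x<n → sym (in-range x x<n g)) ⟩
    ∑< n (λ x → 𝟙 (p x <ᵇ n) * g x)      ≡⟨ ∑<-involution n n g ⟩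
    ∑< n (λ y → 𝟙 (p y <ᵇ n) * g (p y))  ≡⟨ ∑<-cong n (λ y y<n → in-range y y<n (g ∘ p)) ⟩
    ∑< n (g ∘ p)                         ∎
    where
      open ≡-Reasoning
      in-range : ∀ x → x < n → (h : ℕ → ℕ) → 𝟙 (p x <ᵇ n) * h x ≡ h x
      in-range x x<n h rewrite <ᵇ-true (p-bound x x<n) = +-identityʳ (h x)

sumℤ-zero : ∀ k (f : Fin k → ℤ) → (∀ j → f j ≡ 0ℤ) → sumℤ (tabulate f) ≡ 0ℤ
sumℤ-zero zero    f f≡0 = refl
sumℤ-zero (suc k) f f≡0 rewrite f≡0 Fin.zero | sumℤ-zero k (f ∘ Fin.suc) (f≡0 ∘ Fin.suc) = refl

sumℤ-single : ∀ k (f : Fin k → ℤ) c → (∀ j → j ≢ c → f j ≡ 0ℤ) → sumℤ (tabulate f) ≡ f c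
sumℤ-single (suc k) f Fin.zero f≡0
  rewrite sumℤ-zero k (f ∘ Fin.suc) (λ j → f≡0 (Fin.suc j) λ ()) = ℤ.+-identityʳ (f Fin.zero)
sumℤ-single (suc k) f (Fin.suc c) f≡0
  rewrite f≡0 Fin.zero (λ ()) = trans (ℤ.+-identityˡ _)
    (sumℤ-single k (f ∘ Fin.suc) c (λ j j≢c → f≡0 (Fin.suc j) (j≢c ∘ suc-injective)))

delete₀ : ∀ {k} → (Fin (suc k) → Fin (suc k) → ℤ) → Fin (suc k) → Fin k → Fin k → ℤ
delete₀ B j a b = B (Fin.suc a) (punchIn j b)

laplaceTerm : ∀ {k} → (Fin (suc k) → Fin (suc k) → ℤ) → Fin (suc k) → ℤ
laplaceTerm B j = alt (toℕ j) ℤ.* (B Fin.zero j ℤ.* det (delete₀ B j))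

det-expand : ∀ k (B : Fin (suc k) → Fin (suc k) → ℤ) → det B ≡ sumℤ (tabulate (laplaceTerm B))
det-expand k B = cong sumℤ (map-tabulate (λ j → j) (laplaceTerm B))

laplaceTerm-entry : ∀ {k} (B : Fin (suc k) → Fin (suc k) → ℤ) j → B Fin.zero j ≡ 0ℤ → laplaceTerm B j ≡ 0ℤ
laplaceTerm-entry B j B0j≡0 rewrite B0j≡0 = ℤ.*-zeroʳ (alt (toℕ j))

laplaceTerm-minor : ∀ {k} (B : Fin (suc k) → Fin (suc k) → ℤ) j →
  det (delete₀ B j) ≡ 0ℤ → laplaceTerm B j ≡ 0ℤ
laplaceTerm-minor B j det≡0 rewrite det≡0 | ℤ.*-zeroʳ (B Fin.zero j) = ℤ.*-zeroʳ (alt (toℕ j))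

-- A matrix with a zero row has determinant zero (expanding along row 0, or recursing into
-- the minors when the zero row lies below).
det-zeroRow : ∀ k (B : Fin k → Fin k → ℤ) r → (∀ b → B r b ≡ 0ℤ) → det B ≡ 0ℤ
det-zeroRow (suc k) B Fin.zero    row≡0 =
  trans (det-expand k B) (sumℤ-zero (suc k) _ (λ j → laplaceTerm-entry B j (row≡0 j)))
det-zeroRow (suc k) B (Fin.suc r) row≡0 =
  trans (det-expand k B) (sumℤ-zero (suc k) _ (λ j →
    laplaceTerm-minor B j (det-zeroRow k (delete₀ B j) r (λ b → row≡0 (punchIn j b)))))

nonzeroRow : ∀ k (B : Fin k → Fin k → ℤ) → det B ≢ 0ℤ → ∀ a → ∃ λ b → B a b ≢ 0ℤ
nonzeroRow k B det≢0 a =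
  ¬∀⟶∃¬ k (λ b → B a b ≡ 0ℤ) (λ b → B a b ℤ.≟ 0ℤ) (λ row≡0 → det≢0 (det-zeroRow k B a row≡0))

Unit : ℤ → Set
Unit z = z ≡ 1ℤ ⊎ z ≡ -1ℤ

unit-* : ∀ {a b} → Unit a → Unit b → Unit (a ℤ.* b)
unit-* (inj₁ refl) (inj₁ refl) = inj₁ refl
unit-* (inj₁ refl) (inj₂ refl) = inj₂ refl
unit-* (inj₂ refl) (inj₁ refl) = inj₂ refl
unit-* (inj₂ refl) (inj₂ refl) = inj₁ refl

unit-alt : ∀ k → Unit (alt k)
unit-alt zero    = inj₁ refl
unit-alt (suc k) with unit-alt k
... | inj₁ alt≡1  = inj₂ (cong -_ alt≡1)
... | inj₂ alt≡-1 = inj₁ (cong -_ alt≡-1)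

unit⇒nonzero : ∀ {z} → Unit z → T (nonzero z)
unit⇒nonzero (inj₁ refl) = tt
unit⇒nonzero (inj₂ refl) = tt

nonzero⇒≢0 : ∀ {z} → T (nonzero z) → z ≢ 0ℤ
nonzero⇒≢0 z≢0 refl = z≢0

-- A monomial matrix (exactly one entry in each row, at columns σ a forming a permutation) whose
-- entries are units has a unit determinant: expanding along row 0 leaves a single term.
det-monomial : ∀ k (B : Fin k → Fin k → ℤ) (σ : Fin k → Fin k) → Injective _≡_ _≡_ σ →
  (∀ a → Unit (B a (σ a))) → (∀ a b → b ≢ σ a → B a b ≡ 0ℤ) → Unit (det B)
det-monomial zero    B σ σ-inj B-unit B-zero = inj₁ refl
det-monomial (suc k) B σ σ-inj B-unit B-zero
  rewrite det-expand k B
        | sumℤ-single (suc k) (laplaceTerm B) (σ Fin.zero)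
                      (λ j j≢c → laplaceTerm-entry B j (B-zero Fin.zero j j≢c))
  = unit-* (unit-alt (toℕ c))
           (unit-* (B-unit Fin.zero) (det-monomial k (delete₀ B c) σ′ σ′-inj B′-unit B′-zero))
  where
    c = σ Fin.zero
    c≢σsuc : ∀ a → c ≢ σ (Fin.suc a)
    c≢σsuc a c≡σa with σ-inj c≡σa
    ... | ()
    -- the permutation induced on the remaining rows and columns
    σ′ : Fin k → Fin k
    σ′ a = punchOut (c≢σsuc a)
    σ′-inj : Injective _≡_ _≡_ σ′
    σ′-inj e = suc-injective (σ-inj (punchOut-injective (c≢σsuc _) (c≢σsuc _) e))
    B′-unit : ∀ a → Unit (delete₀ B c a (σ′ a))
    B′-unit a rewrite punchIn-punchOut (c≢σsuc a) = B-unit (Fin.suc a)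
    B′-zero : ∀ a b → b ≢ σ′ a → delete₀ B c a b ≡ 0ℤ
    B′-zero a b b≢σ′a = B-zero (Fin.suc a) (punchIn c b)
      (λ e → b≢σ′a (punchIn-injective c b (σ′ a) (trans e (sym (punchIn-punchOut (c≢σsuc a))))))

Distinct : ∀ {m k} → Vec (Fin m) k → Set
Distinct v = Injective _≡_ _≡_ (lookup v)

cons₀ : ∀ {m k} → Vec (Fin m) k → Vec (Fin (suc m)) (suc k)
cons₀ v = Fin.zero ∷ Vec.map Fin.suc v

distinct-mapSuc : ∀ {m k} {v : Vec (Fin m) k} → Distinct v → Distinct (Vec.map Fin.suc v)
distinct-mapSuc {v = v} v-distinct {a} {b} e
  rewrite lookup-map a Fin.suc v | lookup-map b Fin.suc v = v-distinct (suc-injective e)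

distinct-cons₀ : ∀ {m k} {v : Vec (Fin m) k} → Distinct v → Distinct (cons₀ v)
distinct-cons₀ {v = v} v-distinct {Fin.zero}  {Fin.zero}  e = refl
distinct-cons₀ {v = v} v-distinct {Fin.zero}  {Fin.suc b} e rewrite lookup-map b Fin.suc v with e
... | ()
distinct-cons₀ {v = v} v-distinct {Fin.suc a} {Fin.zero}  e rewrite lookup-map a Fin.suc v with e
... | ()
distinct-cons₀ {v = v} v-distinct {Fin.suc a} {Fin.suc b} e =
  cong Fin.suc (distinct-mapSuc {v = v} v-distinct e)

choose-distinct : ∀ m k {v : Vec (Fin m) k} → v ∈ choose m k → Distinct v
choose-distinct m       zero    (here refl) {()}
choose-distinct zero    (suc k) ()
choose-distinct (suc m) (suc k) v∈ with ∈-++⁻ (map cons₀ (choose m k)) v∈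
... | inj₁ v∈₁ with ∈-map⁻ cons₀ v∈₁
...   | w , w∈ , refl = distinct-cons₀ {v = w} (choose-distinct m k w∈)
choose-distinct (suc m) (suc k) v∈ | inj₂ v∈₂ with ∈-map⁻ (Vec.map Fin.suc) v∈₂
...   | w , w∈ , refl = distinct-mapSuc {v = w} (choose-distinct m (suc k) w∈)

cons₀-∈-choose : ∀ {m k} {v : Vec (Fin m) k} → v ∈ choose m k → cons₀ v ∈ choose (suc m) (suc k)
cons₀-∈-choose v∈ = ∈-++⁺ˡ (∈-map⁺ cons₀ v∈)

mapSuc-∈-choose : ∀ {m} k {v : Vec (Fin m) k} → v ∈ choose m k → Vec.map Fin.suc v ∈ choose (suc m) k
mapSuc-∈-choose zero    {[]} _  = here refl
mapSuc-∈-choose (suc k)      v∈ = ∈-++⁺ʳ _ (∈-map⁺ (Vec.map Fin.suc) v∈)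

count : (ℕ → Bool) → ℕ → ℕ
count P m = ∑< m (𝟙 ∘ P)

enum : (P : ℕ → Bool) → (m : ℕ) → Vec (Fin m) (count P m)
enum P zero    = []
enum P (suc m) with P 0
... | true  = cons₀ (enum (P ∘ suc) m)
... | false = Vec.map Fin.suc (enum (P ∘ suc) m)

enum-∈-choose : ∀ (P : ℕ → Bool) m → enum P m ∈ choose m (count P m)
enum-∈-choose P zero    = here refl
enum-∈-choose P (suc m) with P 0
... | true  = cons₀-∈-choose (enum-∈-choose (P ∘ suc) m)
... | false = mapSuc-∈-choose (count (P ∘ suc) m) {enum (P ∘ suc) m} (enum-∈-choose (P ∘ suc) m)

enum-sound : ∀ (P : ℕ → Bool) m a → P (toℕ (lookup (enum P m) a)) ≡ true
enum-sound P (suc m) a with P 0 in P0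
enum-sound P (suc m) Fin.zero    | true = P0
enum-sound P (suc m) (Fin.suc a) | true
  rewrite lookup-map a Fin.suc (enum (P ∘ suc) m) = enum-sound (P ∘ suc) m a
enum-sound P (suc m) a           | false
  rewrite lookup-map a Fin.suc (enum (P ∘ suc) m) = enum-sound (P ∘ suc) m a

enum-complete : ∀ (P : ℕ → Bool) m x → x < m → P x ≡ true → ∃ λ a → toℕ (lookup (enum P m) a) ≡ x
enum-complete P (suc m) x x<m Px with P 0 in P0
enum-complete P (suc m) zero    _         Px | true  = Fin.zero , refl
enum-complete P (suc m) zero    _         Px | false with () ← trans (sym P0) Px
enum-complete P (suc m) (suc x) (s<s x<m) Px | true
  with a , e ← enum-complete (P ∘ suc) m x x<m Px
  = Fin.suc a , trans (cong toℕ (lookup-map a Fin.suc (enum (P ∘ suc) m))) (cong suc e)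
enum-complete P (suc m) (suc x) (s<s x<m) Px | false
  with a , e ← enum-complete (P ∘ suc) m x x<m Px
  = a , trans (cong toℕ (lookup-map a Fin.suc (enum (P ∘ suc) m))) (cong suc e)

count-last : ∀ (P : ℕ → Bool) m → count P (suc m) ≡ count P m + 𝟙 (P m)
count-last P m = ∑<-last m (𝟙 ∘ P)

count≤ : ∀ (P : ℕ → Bool) m → count P m ≤ m
count≤ P zero    = z≤n
count≤ P (suc m) = +-mono-≤ (𝟙≤1 (P 0)) (count≤ (P ∘ suc) m)

count-mono : ∀ (P : ℕ → Bool) {x y} → x ≤ y → count P x ≤ count P y
count-mono P {x} {zero}  z≤n = ≤-refl
count-mono P {x} {suc y} x≤1+y with m≤n⇒m<n∨m≡n x≤1+y
... | inj₂ refl      = ≤-refl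
... | inj₁ (s≤s x≤y) =
  ≤-trans (count-mono P x≤y) (≤-trans (m≤m+n _ _) (≤-reflexive (sym (count-last P y))))

count-strict : ∀ (P : ℕ → Bool) {x y} → x < y → P x ≡ true → count P x < count P y
count-strict P {x} x<y Px = ≤-trans passing-x (count-mono P x<y)
  where passing-x : suc (count P x) ≤ count P (suc x)
        passing-x rewrite count-last P x | Px = ≤-reflexive (+-comm 1 (count P x))

-- k distinct elements of P below m show k ≤ count P m: the position of each of them within P is
-- an injection of Fin k into Fin (count P m).
count-injection : ∀ k m (P : ℕ → Bool) (f : Fin k → ℕ) → Injective _≡_ _≡_ f →
  (∀ a → f a < m) → (∀ a → P (f a) ≡ true) → k ≤ count P m
count-injection k m P f f-inj f<m Pf = injective⇒≤ position-inj
  where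
    position : Fin k → Fin (count P m)
    position a = fromℕ< (count-strict P (f<m a) (Pf a))
    position-inj : Injective _≡_ _≡_ position
    position-inj {a} {b} e with <-cmp (f a) (f b)
    ... | tri≈ _ fa≡fb _ = f-inj fa≡fb
    ... | tri< fa<fb _ _ = ⊥-elim (<⇒≢ (count-strict P fa<fb (Pf a))
                             (trans (sym (toℕ-fromℕ< _)) (trans (cong toℕ e) (toℕ-fromℕ< _))))
    ... | tri> _ _ fb<fa = ⊥-elim (<⇒≢ (count-strict P fb<fa (Pf b))
                             (trans (sym (toℕ-fromℕ< _)) (trans (cong toℕ (sym e)) (toℕ-fromℕ< _))))

minor : ∀ {m q k} → (Fin m → Fin q → ℤ) → Vec (Fin m) k → Vec (Fin q) k → Fin k → Fin k → ℤ
minor A rs cs a b = A (lookup rs a) (lookup cs b)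

hasMinor-intro : ∀ {m q k} (A : Fin m → Fin q → ℤ) {rs cs} → rs ∈ choose m k → cs ∈ choose q k →
  T (nonzero (det (minor A rs cs))) → T (hasMinor A k)
hasMinor-intro A rs∈ cs∈ nz = any⁺ _ (lose rs∈ (any⁺ _ (lose cs∈ nz)))

hasMinor-elim : ∀ {m q} (A : Fin m → Fin q → ℤ) k → T (hasMinor A k) →
  ∃ λ rs → ∃ λ cs → rs ∈ choose m k × cs ∈ choose q k × T (nonzero (det (minor A rs cs)))
hasMinor-elim {m} {q} A k has
  with rs , rs∈ , has-cs ← find (any⁻ _ (choose m k) has)
  with cs , cs∈ , nz ← find (any⁻ _ (choose q k) has-cs)
  = rs , cs , rs∈ , cs∈ , nz

rank-≡ : ∀ {m q} (A : Fin m → Fin q → ℤ) N → T (hasMinor A N) → (∀ k → N < k → ¬ T (hasMinor A k)) →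
  N ≤ m → rank A ≡ N
rank-≡ {m} A N has-N none-above = rankFrom-≡ m
  where
    rankFrom-≡ : ∀ m′ → N ≤ m′ → rankFrom A m′ ≡ N
    rankFrom-≡ zero     z≤n    = refl
    rankFrom-≡ (suc m′) N≤1+m′ with m≤n⇒m<n∨m≡n N≤1+m′
    ... | inj₂ refl rewrite T⇒≡true has-N = refl
    ... | inj₁ (s≤s N≤m′) rewrite ¬T⇒≡false (none-above (suc m′) (s≤s N≤m′)) = rankFrom-≡ m′ N≤m′

module InvolutionCounts (p : ℕ → ℕ) (p-inv : ∀ x → p (p x) ≡ x) where
  open InvolutionSums p p-inv

  live : ℕ → Bool
  live x = not (p x ≡ᵇ x)

  live-p : ∀ x → live (p x) ≡ live x
  live-p x rewrite p-inv x = cong not (≡ᵇ-sym x (p x))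

  -- R j x: row x of M_π has its nonzero entry in one of the first j columns.
  R : ℕ → ℕ → Bool
  R j x = (p x <ᵇ j) ∧ live x

  R-intro : ∀ j x → p x < j → p x ≢ x → R j x ≡ true
  R-intro j x px<j px≢x rewrite <ᵇ-true px<j | ≡ᵇ-false px≢x = refl

  R-elim : ∀ j x → R j x ≡ true → p x < j × p x ≢ x
  R-elim j x Rjx with p x <ᵇ j in px<j | p x ≡ᵇ x in px≡x
  ... | true  | false = <ᵇ-true⁻¹ (p x) j px<j , ≡ᵇ-false⁻¹ px≡x
  ... | true  | true  with () ← Rjx
  ... | false | _     with () ← Rjx

  -- r i j = the number of nonzero entries in the upper-left i×j corner.
  r : ℕ → ℕ → ℕ
  r i j = count (R j) i

  -- The nonzero entries of the i×j and of the j×i corner correspond under x ↦ p x.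
  r-sym : ∀ i j → r i j ≡ r j i
  r-sym i j = begin
    ∑< i (λ x → 𝟙 (R j x))                       ≡⟨ ∑<-cong i (λ x _ → 𝟙-∧ (p x <ᵇ j) (live x)) ⟩
    ∑< i (λ x → 𝟙 (p x <ᵇ j) * 𝟙 (live x))       ≡⟨ ∑<-involution i j (𝟙 ∘ live) ⟩
    ∑< j (λ y → 𝟙 (p y <ᵇ i) * 𝟙 (live (p y)))
      ≡⟨ ∑<-cong j (λ y _ → cong (λ b → 𝟙 (p y <ᵇ i) * 𝟙 b) (live-p y)) ⟩
    ∑< j (λ y → 𝟙 (p y <ᵇ i) * 𝟙 (live y))       ≡⟨ ∑<-cong j (λ y _ → sym (𝟙-∧ (p y <ᵇ i) (live y))) ⟩
    ∑< j (λ y → 𝟙 (R i y))                       ∎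
    where open ≡-Reasoning

  -- Adding row a and column b: the new row contributes [R (b+1) a], and by symmetry the new column
  -- contributes [R a b].
  r-step : ∀ a b → r (suc a) (suc b) ≡ r a b + (𝟙 (R (suc b) a) + 𝟙 (R a b))
  r-step a b = begin
    r (suc a) (suc b)                       ≡⟨ count-last (R (suc b)) a ⟩
    r a (suc b) + 𝟙 (R (suc b) a)           ≡⟨ cong (_+ 𝟙 (R (suc b) a)) new-column ⟩
    r a b + 𝟙 (R a b) + 𝟙 (R (suc b) a)     ≡⟨ +-assoc (r a b) _ _ ⟩
    r a b + (𝟙 (R a b) + 𝟙 (R (suc b) a))   ≡⟨ cong (r a b +_) (+-comm (𝟙 (R a b)) _) ⟩
    r a b + (𝟙 (R (suc b) a) + 𝟙 (R a b))   ∎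
    where
      open ≡-Reasoning
      new-column : r a (suc b) ≡ r a b + 𝟙 (R a b)
      new-column = trans (r-sym a (suc b)) (trans (count-last (R a) b) (cong (_+ 𝟙 (R a b)) (r-sym b a)))

  r-step-unchanged : ∀ a b → (r (suc a) (suc b) ≡ᵇ r a b) ≡ not (R (suc b) a) ∧ not (R a b)
  r-step-unchanged a b rewrite r-step a b =
    trans (+-≡ᵇ-self (r a b) _) (𝟙+𝟙-≡ᵇ-0 (R (suc b) a) (R a b))

-- A is a signed involution matrix for p: its nonzero entries are units, sitting exactly at the
-- positions (x, p x) with x live.  Then the rank of each corner is its number of nonzero entries.
module SignedInvolutionMatrix
  (p : ℕ → ℕ) (p-inv : ∀ x → p (p x) ≡ x) (A : ℕ → ℕ → ℤ)
  (A-support : ∀ x y → A x y ≢ 0ℤ → y ≡ p x × p x ≢ x)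
  (A-unit : ∀ x → p x ≢ x → Unit (A x (p x)))
  where
  open InvolutionCounts p p-inv

  corner : ∀ i j → Fin i → Fin j → ℤ
  corner i j a b = A (toℕ a) (toℕ b)

  partner-R : ∀ i j (x : Fin i) → R j (toℕ x) ≡ true → R i (p (toℕ x)) ≡ true
  partner-R i j x Rjx = R-intro i (p (toℕ x)) (subst (_< i) (sym (p-inv (toℕ x))) (toℕ<n x))
    (λ ppx≡px → proj₂ (R-elim j (toℕ x) Rjx) (sym (trans (sym (p-inv (toℕ x))) ppx≡px)))

  -- Rows rs, all carrying a nonzero entry within the first j columns, against the columns
  -- {y < j : R i y} holding those entries, form a unit monomial minor.
  partner-minor : ∀ i j k → r j i ≡ k → (rs : Vec (Fin i) k) → rs ∈ choose i k →
    (∀ a → R j (toℕ (lookup rs a)) ≡ true) → T (hasMinor (corner i j) k)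
  partner-minor i j .(r j i) refl rs rs∈ rs-R =
    hasMinor-intro (corner i j) rs∈ (enum-∈-choose (R i) j)
      (unit⇒nonzero (det-monomial _ (minor (corner i j) rs cs) σ σ-inj σ-unit σ-zero))
    where
      cs = enum (R i) j
      row : _ → ℕ
      row a = toℕ (lookup rs a)
      col : _ → ℕ
      col b = toℕ (lookup cs b)
      partner : ∀ a → ∃ λ b → col b ≡ p (row a)
      partner a = enum-complete (R i) j (p (row a)) (proj₁ (R-elim j (row a) (rs-R a)))
                                (partner-R i j _ (rs-R a))
      σ : _ → _
      σ a = proj₁ (partner a)
      σ-inj : Injective _≡_ _≡_ σ
      σ-inj {a} {a′} σa≡σa′ = choose-distinct i _ rs∈ (toℕ-injective (begin
        row a           ≡⟨ sym (p-inv (row a)) ⟩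
        p (p (row a))   ≡⟨ cong p (sym (proj₂ (partner a))) ⟩
        p (col (σ a))   ≡⟨ cong (p ∘ col) σa≡σa′ ⟩
        p (col (σ a′))  ≡⟨ cong p (proj₂ (partner a′)) ⟩
        p (p (row a′))  ≡⟨ p-inv (row a′) ⟩
        row a′          ∎))
        where open ≡-Reasoning
      σ-unit : ∀ a → Unit (minor (corner i j) rs cs a (σ a))
      σ-unit a rewrite proj₂ (partner a) = A-unit (row a) (proj₂ (R-elim j (row a) (rs-R a)))
      σ-zero : ∀ a b → b ≢ σ a → minor (corner i j) rs cs a b ≡ 0ℤ
      σ-zero a b b≢σa with A (row a) (col b) ℤ.≟ 0ℤ
      ... | yes entry≡0 = entry≡0
      ... | no  entry≢0 = ⊥-elim (b≢σa (choose-distinct j _ (enum-∈-choose (R i) j)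
              (toℕ-injective (trans (proj₁ (A-support _ _ entry≢0)) (sym (proj₂ (partner a)))))))

  -- The rows {x < i : R j x} give such a minor, of size r i j (the columns number r j i = r i j).
  corner-minor : ∀ i j → T (hasMinor (corner i j) (r i j))
  corner-minor i j =
    partner-minor i j (r i j) (r-sym j i) (enum (R j) i) (enum-∈-choose (R j) i) (enum-sound (R j) i)

  -- A nonzero k×k minor has a nonzero entry in each of its k distinct rows, so k ≤ r i j.
  corner-no-larger : ∀ i j k → r i j < k → ¬ T (hasMinor (corner i j) k)
  corner-no-larger i j k r<k has-k with rs , cs , rs∈ , cs∈ , nz ← hasMinor-elim (corner i j) k has-k =
    <⇒≱ r<k (count-injection k i (R j) row (choose-distinct i k rs∈ ∘ toℕ-injective)
                              (λ a → toℕ<n (lookup rs a)) row-R)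
    where
      row : Fin k → ℕ
      row a = toℕ (lookup rs a)
      row-R : ∀ a → R j (row a) ≡ true
      row-R a with b , entry≢0 ← nonzeroRow k (minor (corner i j) rs cs) (nonzero⇒≢0 nz) a
              with col≡px , px≢x ← A-support _ _ entry≢0 =
        R-intro j (row a) (subst (_< j) col≡px (toℕ<n (lookup cs b))) px≢x

  rank-corner : ∀ i j → rank (corner i j) ≡ r i j
  rank-corner i j = rank-≡ (corner i j) (r i j) (corner-minor i j) (corner-no-larger i j) (count≤ (R j) i)

module _ {A : Set} {P : A → Set} (P? : (x : A) → Dec (P x)) where

  length-filter-∷ : ∀ x xs → length (filter P? (x ∷ xs)) ≡ 𝟙 (does (P? x)) + length (filter P? xs)
  length-filter-∷ x xs with does (P? x)
  ... | true  = refl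
  ... | false = refl

  length-filter : ∀ xs → length (filter P? xs) ≡ sum (map (𝟙 ∘ does ∘ P?) xs)
  length-filter []       = refl
  length-filter (x ∷ xs) = trans (length-filter-∷ x xs) (cong (𝟙 (does (P? x)) +_) (length-filter xs))

  sum-filter : ∀ (g : A → ℕ) xs → sum (map g (filter P? xs)) ≡ sum (map (λ x → 𝟙 (does (P? x)) * g x) xs)
  sum-filter g []       = refl
  sum-filter g (x ∷ xs) with does (P? x)
  ... | true  = cong₂ _+_ (sym (+-identityʳ (g x))) (sum-filter g xs)
  ... | false = sum-filter g xs

sum-map-concatMap : ∀ {A B : Set} (f : B → ℕ) (g : A → List B) xs →
  sum (map f (concatMap g xs)) ≡ sum (map (λ x → sum (map f (g x))) xs)
sum-map-concatMap f g []       = refl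
sum-map-concatMap f g (x ∷ xs) = begin
  sum (map f (g x ++ concatMap g xs))                 ≡⟨ cong sum (map-++ f (g x) (concatMap g xs)) ⟩
  sum (map f (g x) ++ map f (concatMap g xs))         ≡⟨ sum-++ (map f (g x)) _ ⟩
  sum (map f (g x)) + sum (map f (concatMap g xs))
    ≡⟨ cong (sum (map f (g x)) +_) (sum-map-concatMap f g xs) ⟩
  sum (map f (g x)) + sum (map (λ x → sum (map f (g x))) xs) ∎
  where open ≡-Reasoning

sum-map-+ : ∀ {A : Set} (f g : A → ℕ) xs → sum (map (λ x → f x + g x) xs) ≡ sum (map f xs) + sum (map g xs)
sum-map-+ f g []       = refl
sum-map-+ f g (x ∷ xs) rewrite sum-map-+ f g xs = interchange (f x) (g x) _ _
  where interchange : ∀ a b c d → a + b + (c + d) ≡ a + c + (b + d)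
        interchange = solve-∀

sum-applyUpTo : ∀ (f : ℕ → ℕ) n → sum (applyUpTo f n) ≡ ∑< n f
sum-applyUpTo f zero    = refl
sum-applyUpTo f (suc n) = cong (f 0 +_) (sum-applyUpTo (f ∘ suc) n)

sum-tabulate : ∀ n (f : Fin n → ℕ) → sum (tabulate f) ≡ FinSum.sum f
sum-tabulate zero    f = refl
sum-tabulate (suc n) f = cong (f Fin.zero +_) (sum-tabulate n (f ∘ Fin.suc))

length-filter-pairs : ∀ {P : ℕ × ℕ → Set} (P? : (q : ℕ × ℕ) → Dec (P q)) n →
  length (filter P? (concatMap (λ i → map (λ j → (i , j)) (map suc (upTo n))) (map suc (upTo n))))
    ≡ ∑< n (λ a → ∑< n (λ b → 𝟙 (does (P? (suc a , suc b)))))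
length-filter-pairs P? n = begin
  length (filter P? (concatMap row idx))
    ≡⟨ length-filter P? (concatMap row idx) ⟩
  sum (map (𝟙 ∘ does ∘ P?) (concatMap row idx))
    ≡⟨ sum-map-concatMap (𝟙 ∘ does ∘ P?) row idx ⟩
  sum (map (λ i → sum (map (𝟙 ∘ does ∘ P?) (row i))) idx)
    ≡⟨ cong sum (map-cong (λ i → cong sum (sym (map-∘ idx))) idx) ⟩
  sum (map (λ i → sum (map (λ j → 𝟙 (does (P? (i , j)))) idx)) idx)
    ≡⟨ sum-idx (λ i → sum (map (λ j → 𝟙 (does (P? (i , j)))) idx)) ⟩
  ∑< n (λ a → sum (map (λ j → 𝟙 (does (P? (suc a , j)))) idx))
    ≡⟨ ∑<-cong n (λ a _ → sum-idx (λ j → 𝟙 (does (P? (suc a , j))))) ⟩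
  ∑< n (λ a → ∑< n (λ b → 𝟙 (does (P? (suc a , suc b))))) ∎
  where
    open ≡-Reasoning
    idx = map suc (upTo n)
    row : ℕ → List (ℕ × ℕ)
    row i = map (λ j → (i , j)) idx
    sum-idx : ∀ h → sum (map h idx) ≡ ∑< n (h ∘ suc)
    sum-idx h = trans (cong sum (trans (sym (map-∘ (upTo n))) (map-upTo (h ∘ suc) n)))
                      (sum-applyUpTo (h ∘ suc) n)

pairSum : {A : Set} → List A → (A → A → ℕ) → ℕ
pairSum []      Q = 0
pairSum (a ∷ L) Q = sum (map (Q a) L) + pairSum L Q

pairSum-filter : ∀ {A : Set} {P : A → Set} (P? : (x : A) → Dec (P x)) xs Q →
  pairSum (filter P? xs) Q ≡ pairSum xs (λ a c → 𝟙 (does (P? a)) * (𝟙 (does (P? c)) * Q a c))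
pairSum-filter P? []       Q = refl
pairSum-filter P? (x ∷ xs) Q with does (P? x)
... | true  = cong₂ _+_ (trans (sum-filter P? (Q x) xs) (cong sum (map-cong (λ c → sym (*-identityˡ _)) xs)))
                        (pairSum-filter P? xs Q)
... | false = trans (pairSum-filter P? xs Q) (cong (_+ pairSum xs _) (sym (sum-zeros xs)))
  where sum-zeros : ∀ ys → sum (map (λ c → 0 * (𝟙 (does (P? c)) * Q x c)) ys) ≡ 0
        sum-zeros []       = refl
        sum-zeros (_ ∷ ys) = sum-zeros ys

pairSum-tabulate : ∀ {A : Set} n (g : Fin n → A) Q →
  pairSum (tabulate g) Q ≡ FinSum.sum (λ i → FinSum.sum (λ j → 𝟙 (toℕ i <ᵇ toℕ j) * Q (g i) (g j)))
pairSum-tabulate zero    g Q = refl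
pairSum-tabulate (suc n) g Q = cong₂ _+_
  (trans (cong sum (map-tabulate (g ∘ Fin.suc) (Q (g Fin.zero))))
         (trans (sum-tabulate n _) (FinSum.sum-cong-≗ {n} (λ j → sym (+-identityʳ _)))))
  (pairSum-tabulate n (g ∘ Fin.suc) Q)

blockWord : {A : Set} → (A → ℕ) → (A → ℕ) → List A → List ℕ
blockWord lo hi = concatMap (λ a → lo a ∷ hi a ∷ [])

below : ℕ → List ℕ → ℕ
below t xs = length (filter (_<? t) xs)

-- The inversions between a block x x′ and a later block y y′.
blockInversions : ℕ → ℕ → ℕ → ℕ → ℕ
blockInversions x x′ y y′ = 𝟙 (y <ᵇ x) + 𝟙 (y′ <ᵇ x) + (𝟙 (y <ᵇ x′) + 𝟙 (y′ <ᵇ x′))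

below-blockWord : ∀ {A : Set} (lo hi : A → ℕ) t L →
  below t (blockWord lo hi L) ≡ sum (map (λ c → 𝟙 (lo c <ᵇ t) + 𝟙 (hi c <ᵇ t)) L)
below-blockWord lo hi t []      = refl
below-blockWord lo hi t (c ∷ L) = begin
  below t (lo c ∷ hi c ∷ W)
    ≡⟨ length-filter-∷ (_<? t) (lo c) (hi c ∷ W) ⟩
  𝟙 (lo c <ᵇ t) + below t (hi c ∷ W)
    ≡⟨ cong (𝟙 (lo c <ᵇ t) +_) (length-filter-∷ (_<? t) (hi c) W) ⟩
  𝟙 (lo c <ᵇ t) + (𝟙 (hi c <ᵇ t) + below t W)
    ≡⟨ sym (+-assoc (𝟙 (lo c <ᵇ t)) _ _) ⟩
  𝟙 (lo c <ᵇ t) + 𝟙 (hi c <ᵇ t) + below t W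
    ≡⟨ cong (𝟙 (lo c <ᵇ t) + 𝟙 (hi c <ᵇ t) +_) (below-blockWord lo hi t L) ⟩
  𝟙 (lo c <ᵇ t) + 𝟙 (hi c <ᵇ t) + sum (map (λ c → 𝟙 (lo c <ᵇ t) + 𝟙 (hi c <ᵇ t)) L) ∎
  where
    open ≡-Reasoning
    W = blockWord lo hi L

inversions-blockWord : ∀ {A : Set} (lo hi : A → ℕ) L →
  inversions (blockWord lo hi L)
    ≡ sum (map (λ a → 𝟙 (hi a <ᵇ lo a)) L) + pairSum L (λ a c → blockInversions (lo a) (hi a) (lo c) (hi c))
inversions-blockWord lo hi []      = refl
inversions-blockWord lo hi (a ∷ L) = begin
  below (lo a) (hi a ∷ W) + (below (hi a) W + inversions W)
    ≡⟨ cong (_+ (below (hi a) W + inversions W)) (length-filter-∷ (_<? lo a) (hi a) W) ⟩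
  𝟙 (hi a <ᵇ lo a) + below (lo a) W + (below (hi a) W + inversions W)
    ≡⟨ cong₂ (λ u v → 𝟙 (hi a <ᵇ lo a) + u + (v + inversions W))
             (below-blockWord lo hi (lo a) L) (below-blockWord lo hi (hi a) L) ⟩
  𝟙 (hi a <ᵇ lo a) + sum (map B₁ L) + (sum (map B₂ L) + inversions W)
    ≡⟨ cong (λ s → 𝟙 (hi a <ᵇ lo a) + sum (map B₁ L) + (sum (map B₂ L) + s)) (inversions-blockWord lo hi L) ⟩
  𝟙 (hi a <ᵇ lo a) + sum (map B₁ L) + (sum (map B₂ L) + (S + pairSum L Q))
    ≡⟨ rearrange (𝟙 (hi a <ᵇ lo a)) (sum (map B₁ L)) (sum (map B₂ L)) S (pairSum L Q) ⟩
  𝟙 (hi a <ᵇ lo a) + S + ((sum (map B₁ L) + sum (map B₂ L)) + pairSum L Q)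
    ≡⟨ cong (λ s → 𝟙 (hi a <ᵇ lo a) + S + (s + pairSum L Q)) (sym (sum-map-+ B₁ B₂ L)) ⟩
  𝟙 (hi a <ᵇ lo a) + S + (sum (map (Q a) L) + pairSum L Q) ∎
  where
    open ≡-Reasoning
    W  = blockWord lo hi L
    B₁ = λ c → 𝟙 (lo c <ᵇ lo a) + 𝟙 (hi c <ᵇ lo a)
    B₂ = λ c → 𝟙 (lo c <ᵇ hi a) + 𝟙 (hi c <ᵇ hi a)
    S  = sum (map (λ a → 𝟙 (hi a <ᵇ lo a)) L)
    Q  = λ a c → blockInversions (lo a) (hi a) (lo c) (hi c)
    rearrange : ∀ x u v s t → x + u + (v + (s + t)) ≡ x + s + (u + v + t)
    rearrange = solve-∀

module ArcCounting (n : ℕ) (p : ℕ → ℕ) (p-inv : ∀ x → p (p x) ≡ x) (p-bound : ∀ x → x < n → p x < n) where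
  open InvolutionSums p p-inv
  open InvolutionCounts p p-inv

  fixed opener : ℕ → Bool
  fixed  x = p x ≡ᵇ x
  opener x = x <ᵇ p x

  -- The pairs a < b counted by 𝔄: adding row a and column b leaves the corner rank unchanged.
  unchanged : ℕ → ℕ → Bool
  unchanged a b = (a <ᵇ b) ∧ (not (R (suc b) a) ∧ not (R a b))

  -- a < b with a fixed; in particular a fixed point inside the arc (p b, b).
  fixedLeft fixedInside : ℕ → ℕ → Bool
  fixedLeft   a b = (a <ᵇ b) ∧ fixed a
  fixedInside a b = (a <ᵇ b) ∧ (fixed a ∧ (p b <ᵇ a))

  -- a opens an arc (a, p a) and b < p a lies inside it, as the opener of a crossing arc, as the
  -- closer of a nested arc, or as a fixed point.
  crossing nestedCloser coveredFixed : ℕ → ℕ → Bool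
  crossing     a b = (a <ᵇ b) ∧ (opener a ∧ ((b <ᵇ p a) ∧ opener b))
  nestedCloser a b = (a <ᵇ b) ∧ (opener a ∧ ((b <ᵇ p a) ∧ ((p b <ᵇ b) ∧ (a <ᵇ p b))))
  coveredFixed a b = (a <ᵇ b) ∧ (opener a ∧ ((b <ᵇ p a) ∧ fixed b))

  -- The arc opened at c is nested inside the arc opened at a < c.
  nesting : ℕ → ℕ → Bool
  nesting a c = (a <ᵇ c) ∧ (opener a ∧ ((p c <ᵇ p a) ∧ opener c))

  -- Pointwise classification of the pairs a < b: by whether a is fixed, a closer, or an opener,
  -- and for an opener by the position and the type of b.
  classify : ∀ a b → 𝟙 (unchanged a b) + 𝟙 (fixedInside a b)
                   ≡ 𝟙 (fixedLeft a b) + (𝟙 (crossing a b) + (𝟙 (nestedCloser a b) + 𝟙 (coveredFixed a b)))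
  classify a b with <-cmp a b
  ... | tri> _ _ b<a   rewrite <ᵇ-false (<⇒≤ b<a) = refl
  ... | tri≈ _ refl _  rewrite <ᵇ-false (≤-refl {a}) = refl
  ... | tri< a<b _ _   rewrite <ᵇ-true a<b with <-cmp a (p a)
  -- a fixed: the pair is unchanged unless p b < a < b, the fixedInside case
  classify a b | tri< a<b _ _ | tri≈ _ a≡pa _
    rewrite ≡ᵇ-sym (p a) a | sym a≡pa | ≡ᵇ-refl a | <ᵇ-false (≤-refl {a}) | <ᵇ-true (≤-trans a<b (n≤1+n b))
    with <-cmp (p b) a
  ... | tri< pb<a _ _ rewrite <ᵇ-true pb<a | ≡ᵇ-false {p b} {b} (<⇒≢ (<-trans pb<a a<b)) = refl
  ... | tri≈ _ pb≡a _ rewrite <ᵇ-false (≤-reflexive (sym pb≡a)) = refl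
  ... | tri> _ _ a<pb rewrite <ᵇ-false (<⇒≤ a<pb) = refl
  -- a closer: row a already meets a column p a < a < b
  classify a b | tri< a<b _ _ | tri> _ _ pa<a
    rewrite <ᵇ-false (<⇒≤ pa<a) | ≡ᵇ-false {p a} {a} (<⇒≢ pa<a)
          | <ᵇ-true (<-trans pa<a (<-trans a<b (n<1+n b))) = refl
  -- a opener: unchanged iff b lies inside the arc (a, p a) and is not the closer of an arc
  -- starting before a
  classify a b | tri< a<b _ _ | tri< a<pa _ _ rewrite <ᵇ-true a<pa | ≡ᵇ-false {p a} {a} (≢-sym (<⇒≢ a<pa))
    with <-cmp b (p a)
  ... | tri≈ _ b≡pa _ rewrite <ᵇ-false (≤-reflexive (sym b≡pa))
                            | <ᵇ-true (≤-reflexive (cong suc (sym b≡pa))) = refl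
  ... | tri> _ _ pa<b rewrite <ᵇ-false (<⇒≤ pa<b) | <ᵇ-true (<-trans pa<b (n<1+n b)) = refl
  ... | tri< b<pa _ _ rewrite <ᵇ-true b<pa | <ᵇ-false {p a} {suc b} b<pa with <-cmp b (p b)
  ...   | tri< b<pb _ _ rewrite <ᵇ-true b<pb | <ᵇ-false (<⇒≤ b<pb) | ≡ᵇ-false {p b} {b} (≢-sym (<⇒≢ b<pb))
                               | <ᵇ-false (<⇒≤ (<-trans a<b b<pb)) = refl
  ...   | tri≈ _ b≡pb _ rewrite sym b≡pb | <ᵇ-false (≤-refl {b}) | ≡ᵇ-refl b | <ᵇ-false (<⇒≤ a<b) = refl
  ...   | tri> _ _ pb<b rewrite <ᵇ-false (<⇒≤ pb<b) | <ᵇ-true pb<b | ≡ᵇ-false {p b} {b} (<⇒≢ pb<b)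
    with <-cmp a (p b)
  ...     | tri< a<pb _ _ rewrite <ᵇ-true a<pb | <ᵇ-false (<⇒≤ a<pb) = refl
  ...     | tri≈ _ a≡pb _ = ⊥-elim (<-irrefl (trans (sym (p-inv b)) (cong p (sym a≡pb))) b<pa)
  ...     | tri> _ _ pb<a rewrite <ᵇ-false (<⇒≤ pb<a) | <ᵇ-true pb<a = refl

  ∑∑ : (ℕ → ℕ → ℕ) → ℕ
  ∑∑ f = ∑< n (λ a → ∑< n (f a))

  #pairs : (ℕ → ℕ → Bool) → ℕ
  #pairs P = ∑∑ (λ a b → 𝟙 (P a b))

  ∑∑-cong : ∀ {f g : ℕ → ℕ → ℕ} → (∀ a b → f a b ≡ g a b) → ∑∑ f ≡ ∑∑ g
  ∑∑-cong f≗g = ∑<-cong n (λ a _ → ∑<-cong n (λ b _ → f≗g a b))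

  ∑∑-+ : ∀ (f g : ℕ → ℕ → ℕ) → ∑∑ (λ a b → f a b + g a b) ≡ ∑∑ f + ∑∑ g
  ∑∑-+ f g = trans (∑<-cong n (λ a _ → ∑<-+ n (f a) (g a))) (∑<-+ n (λ a → ∑< n (f a)) (λ a → ∑< n (g a)))

  -- Writing b = p c, the closers b of arcs nested inside the arc at a are the openers c of such arcs.
  nestedCloser-reindexed : ∀ a c → 𝟙 (nestedCloser a (p c)) ≡ 𝟙 (nesting a c)
  nestedCloser-reindexed a c rewrite p-inv c with a <ᵇ c in a<ᵇc | a <ᵇ p c in a<ᵇpc
  ... | true  | true  rewrite ∧-identityʳ (c <ᵇ p c) = refl
  ... | false | false = refl
  ... | false | true  rewrite ∧-zeroʳ (c <ᵇ p c) | ∧-zeroʳ (p c <ᵇ p a) | ∧-zeroʳ (a <ᵇ p a) = refl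
  ... | true  | false with c <ᵇ p c in c<ᵇpc
  ...   | false rewrite ∧-zeroʳ (p c <ᵇ p a) | ∧-zeroʳ (a <ᵇ p a) = refl
  ...   | true
    with () ← trans (sym a<ᵇpc) (<ᵇ-true (<-trans (<ᵇ-true⁻¹ a c a<ᵇc) (<ᵇ-true⁻¹ c (p c) c<ᵇpc)))

  -- Writing b = p c, a fixed point a inside the arc (c, p c) is a fixed point covered by that arc.
  fixedInside-reindexed : ∀ a c → 𝟙 (fixedInside a (p c)) ≡ 𝟙 (coveredFixed c a)
  fixedInside-reindexed a c rewrite p-inv c with c <ᵇ a in c<ᵇa
  ... | false rewrite ∧-zeroʳ (p a ≡ᵇ a) | ∧-zeroʳ (a <ᵇ p c) = refl
  ... | true with a <ᵇ p c in a<ᵇpc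
  ...   | false rewrite ∧-zeroʳ (c <ᵇ p c) = refl
  ...   | true with c <ᵇ p c in c<ᵇpc
  ...     | true  rewrite ∧-identityʳ (p a ≡ᵇ a) = refl
  ...     | false
    with () ← trans (sym c<ᵇpc) (<ᵇ-true (<-trans (<ᵇ-true⁻¹ c a c<ᵇa) (<ᵇ-true⁻¹ a (p c) a<ᵇpc)))

  #nestedCloser : #pairs nestedCloser ≡ #pairs nesting
  #nestedCloser = ∑<-cong n (λ a _ →
    trans (∑<-reindex n p-bound (λ b → 𝟙 (nestedCloser a b)))
          (∑<-cong n (λ c _ → nestedCloser-reindexed a c)))

  #fixedInside : #pairs fixedInside ≡ #pairs coveredFixed
  #fixedInside = begin
    ∑< n (λ a → ∑< n (λ b → 𝟙 (fixedInside a b)))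
      ≡⟨ ∑<-cong n (λ a _ → ∑<-reindex n p-bound (λ b → 𝟙 (fixedInside a b))) ⟩
    ∑< n (λ a → ∑< n (λ c → 𝟙 (fixedInside a (p c))))
      ≡⟨ ∑<-comm n n (λ a c → 𝟙 (fixedInside a (p c))) ⟩
    ∑< n (λ c → ∑< n (λ a → 𝟙 (fixedInside a (p c))))
      ≡⟨ ∑∑-cong (λ c a → fixedInside-reindexed a c) ⟩
    ∑< n (λ c → ∑< n (λ a → 𝟙 (coveredFixed c a)))      ∎
    where open ≡-Reasoning

  #unchanged : #pairs unchanged ≡ #pairs fixedLeft + (#pairs crossing + #pairs nesting)
  #unchanged = +-cancelʳ-≡ (#pairs fixedInside) _ _ (begin
    #pairs unchanged + #pairs fixedInside
      ≡⟨ sym (∑∑-+ (λ a b → 𝟙 (unchanged a b)) (λ a b → 𝟙 (fixedInside a b))) ⟩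
    ∑∑ (λ a b → 𝟙 (unchanged a b) + 𝟙 (fixedInside a b))
      ≡⟨ ∑∑-cong classify ⟩
    ∑∑ (λ a b → 𝟙 (fixedLeft a b) + (𝟙 (crossing a b) + (𝟙 (nestedCloser a b) + 𝟙 (coveredFixed a b))))
      ≡⟨ ∑∑-+ (λ a b → 𝟙 (fixedLeft a b))
              (λ a b → 𝟙 (crossing a b) + (𝟙 (nestedCloser a b) + 𝟙 (coveredFixed a b))) ⟩
    F + ∑∑ (λ a b → 𝟙 (crossing a b) + (𝟙 (nestedCloser a b) + 𝟙 (coveredFixed a b)))
      ≡⟨ cong (F +_) (∑∑-+ (λ a b → 𝟙 (crossing a b))
                           (λ a b → 𝟙 (nestedCloser a b) + 𝟙 (coveredFixed a b))) ⟩
    F + (C + ∑∑ (λ a b → 𝟙 (nestedCloser a b) + 𝟙 (coveredFixed a b)))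
      ≡⟨ cong (λ s → F + (C + s)) (∑∑-+ (λ a b → 𝟙 (nestedCloser a b))
                                        (λ a b → 𝟙 (coveredFixed a b))) ⟩
    F + (C + (#pairs nestedCloser + #pairs coveredFixed))
      ≡⟨ cong (λ s → F + (C + s)) (cong₂ _+_ #nestedCloser (sym #fixedInside)) ⟩
    F + (C + (N + #pairs fixedInside))
      ≡⟨ cong (F +_) (sym (+-assoc C N _)) ⟩
    F + (C + N + #pairs fixedInside)
      ≡⟨ sym (+-assoc F (C + N) _) ⟩
    F + (C + N) + #pairs fixedInside ∎)
    where
      open ≡-Reasoning
      F = #pairs fixedLeft
      C = #pairs crossing
      N = #pairs nesting

  arcInversions : ∀ a c → 𝟙 (a <ᵇ c) * (𝟙 (opener a) * (𝟙 (opener c) * blockInversions a (p a) c (p c)))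
                        ≡ 𝟙 (crossing a c) + 𝟙 (nesting a c)
  arcInversions a c with a <ᵇ c in a<ᵇc
  ... | false = refl
  ... | true with a <ᵇ p a
  ...   | false = refl
  ...   | true with c <ᵇ p c in c<ᵇpc
  ...     | false rewrite ∧-zeroʳ (c <ᵇ p a) | ∧-zeroʳ (p c <ᵇ p a) = refl
  ...     | true rewrite ∧-identityʳ (c <ᵇ p a) | ∧-identityʳ (p c <ᵇ p a)
                       | <ᵇ-false (<⇒≤ (<ᵇ-true⁻¹ a c a<ᵇc))
                       | <ᵇ-false (<⇒≤ (<-trans (<ᵇ-true⁻¹ a c a<ᵇc) (<ᵇ-true⁻¹ c (p c) c<ᵇpc)))
    = trans (+-identityʳ _) (trans (+-identityʳ _) (+-identityʳ _))

  fixedLeft-row : ∀ a → ∑< n (λ b → 𝟙 ((a <ᵇ b) ∧ fixed a)) ≡ 𝟙 (fixed a) * (n ∸ suc a)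
  fixedLeft-row a with fixed a
  ... | true  = trans (∑<-cong n (λ b _ → cong 𝟙 (∧-identityʳ (a <ᵇ b))))
                      (trans (∑<-above n a) (sym (+-identityʳ _)))
  ... | false = trans (∑<-cong n (λ b _ → cong 𝟙 (∧-zeroʳ (a <ᵇ b)))) (∑<-zero n)

  opener-block : ∀ a → 𝟙 (opener a) * 𝟙 (p a <ᵇ a) ≡ 0
  opener-block a with a <ᵇ p a in a<ᵇpa
  ... | false = refl
  ... | true rewrite <ᵇ-false (<⇒≤ (<ᵇ-true⁻¹ a (p a) a<ᵇpa)) = refl

module FinInvolution {n : ℕ} (π : Fin n → Fin n) (π-inv : IsInvolution π) where

  p : ℕ → ℕ
  p x with x <? n
  ... | yes x<n = toℕ (π (fromℕ< x<n))
  ... | no  _   = x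

  p-< : ∀ x (x<n : x < n) → p x ≡ toℕ (π (fromℕ< x<n))
  p-< x x<n with x <? n
  ... | yes _   = refl
  ... | no  x≮n = ⊥-elim (x≮n x<n)

  p-≮ : ∀ x → ¬ x < n → p x ≡ x
  p-≮ x x≮n with x <? n
  ... | yes x<n = ⊥-elim (x≮n x<n)
  ... | no  _   = refl

  p-toℕ : ∀ i → p (toℕ i) ≡ toℕ (π i)
  p-toℕ i = trans (p-< (toℕ i) (toℕ<n i)) (cong (toℕ ∘ π) (fromℕ<-toℕ i (toℕ<n i)))

  p-bound : ∀ x → x < n → p x < n
  p-bound x x<n rewrite p-< x x<n = toℕ<n _

  p-inv : ∀ x → p (p x) ≡ x
  p-inv x = by-cases (x <? n)
    where
      by-cases : Dec (x < n) → p (p x) ≡ x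
      by-cases (yes x<n) rewrite p-< x x<n = trans (p-toℕ _) (trans (cong toℕ (π-inv _)) (toℕ-fromℕ< x<n))
      by-cases (no  x≮n) rewrite p-≮ x x≮n = p-≮ x x≮n

  moved-< : ∀ x → p x ≢ x → x < n
  moved-< x px≢x with x <? n
  ... | yes x<n = x<n
  ... | no  _   = ⊥-elim (px≢x refl)

  Mπ-support : ∀ i j → Mπ π i j ≢ 0ℤ → toℕ (π i) ≡ toℕ j × toℕ i ≢ toℕ j
  Mπ-support i j entry≢0 with toℕ (π i) ≡ᵇ toℕ j in πi≡ᵇj
  ... | false = ⊥-elim (entry≢0 refl)
  ... | true with <-cmp (toℕ i) (toℕ j)
  ...   | tri< i<j _ _ = ≡ᵇ-true⁻¹ πi≡ᵇj , <⇒≢ i<j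
  ...   | tri≈ _ _ _   = ⊥-elim (entry≢0 refl)
  ...   | tri> _ _ j<i = ≡ᵇ-true⁻¹ πi≡ᵇj , >⇒≢ j<i

  Mπ-unit : ∀ i j → toℕ (π i) ≡ toℕ j → toℕ i ≢ toℕ j → Unit (Mπ π i j)
  Mπ-unit i j πi≡j i≢j with toℕ (π i) ≡ᵇ toℕ j in πi≡ᵇj
  ... | false = ⊥-elim (≡ᵇ-false⁻¹ πi≡ᵇj πi≡j)
  ... | true with <-cmp (toℕ i) (toℕ j)
  ...   | tri< _ _ _   = inj₁ refl
  ...   | tri≈ _ i≡j _ = ⊥-elim (i≢j i≡j)
  ...   | tri> _ _ _   = inj₂ refl

  Mext-support : ∀ x y → Mext π x y ≢ 0ℤ → y ≡ p x × p x ≢ x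
  Mext-support x y entry≢0 with x <? n | y <? n
  ... | yes x<n | yes y<n with πx≡y , x≢y ← Mπ-support (fromℕ< x<n) (fromℕ< y<n) entry≢0 =
    y≡πx , λ πx≡x → x≢y (trans (toℕ-fromℕ< x<n) (trans (sym πx≡x) (trans (sym y≡πx) (sym (toℕ-fromℕ< y<n)))))
    where y≡πx = trans (sym (toℕ-fromℕ< y<n)) (sym πx≡y)
  ... | yes _ | no _ = ⊥-elim (entry≢0 refl)
  ... | no  _ | _    = ⊥-elim (entry≢0 refl)

  Mext-unit-at : ∀ x y (x<n : x < n) → toℕ (π (fromℕ< x<n)) ≡ y → x ≢ y → Unit (Mext π x y)
  Mext-unit-at x y x<n πx≡y x≢y with x <? n | y <? n
  ... | yes x<n′ | yes y<n = Mπ-unit (fromℕ< x<n′) (fromℕ< y<n) (trans πx≡y (sym (toℕ-fromℕ< y<n)))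
                                     (λ e → x≢y (trans (sym (toℕ-fromℕ< x<n′)) (trans e (toℕ-fromℕ< y<n))))
  ... | yes _    | no y≮n  = ⊥-elim (y≮n (subst (_< n) πx≡y (toℕ<n _)))
  ... | no x≮n   | _       = ⊥-elim (x≮n x<n)

  Mext-unit : ∀ x → p x ≢ x → Unit (Mext π x (p x))
  Mext-unit x px≢x = Mext-unit-at x (p x) (moved-< x px≢x) (sym (p-< x (moved-< x px≢x))) (px≢x ∘ sym)

  open InvolutionCounts p p-inv
  open SignedInvolutionMatrix p p-inv (Mext π) Mext-support Mext-unit
  open ArcCounting n p p-inv p-bound

  rankControl-r : ∀ i j → rankControl π i j ≡ r i j
  rankControl-r = rank-corner

  -- (The conversion to r goes through rankControl-r, stated with rankControl literally, so that no
  -- rank is ever unfolded.)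
  rank-unchanged : ∀ a b →
    (rankControl π (suc a) (suc b) ≡ᵇ rankControl π a b) ≡ not (R (suc b) a) ∧ not (R a b)
  rank-unchanged a b =
    trans (cong₂ _≡ᵇ_ (rankControl-r (suc a) (suc b)) (rankControl-r a b)) (r-step-unchanged a b)

  𝔄-pairs : 𝔄 π ≡ #pairs unchanged
  𝔄-pairs = trans (length-filter-pairs D n)
                  (∑∑-cong (λ a b → cong (λ s → 𝟙 ((a <ᵇ b) ∧ s)) (rank-unchanged a b)))
    where
      D : (q : ℕ × ℕ) → Dec ((proj₁ q < proj₂ q) ×
                             (rankControl π (proj₁ q) (proj₂ q) ≡ rankControl π (proj₁ q ∸ 1) (proj₂ q ∸ 1)))
      D (i , j) = (i <? j) ×-dec (rankControl π i j ≟ rankControl π (i ∸ 1) (j ∸ 1))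

  sum-allFin : ∀ (g : Fin n → ℕ) (f : ℕ → ℕ) → (∀ i → g i ≡ f (toℕ i)) → sum (map g (allFin n)) ≡ ∑< n f
  sum-allFin g f g≗f =
    trans (cong sum (map-tabulate (λ i → i) g)) (trans (sum-tabulate n g) (FinSum.sum-cong-≗ {n} g≗f))

  -- The canonic word of π is the block word of its openers: 𝔍 π is definitionally
  -- inversions (blockWord toℕ (toℕ ∘ π) openers).
  opener? : (i : Fin n) → Dec (toℕ i < toℕ (π i))
  opener? i = toℕ i <? toℕ (π i)

  openers : List (Fin n)
  openers = filter opener? (allFin n)

  openers-not-inverted : sum (map (λ i → 𝟙 (toℕ (π i) <ᵇ toℕ i)) openers) ≡ 0
  openers-not-inverted = begin
    sum (map (λ i → 𝟙 (toℕ (π i) <ᵇ toℕ i)) openers)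
      ≡⟨ sum-filter opener? (λ i → 𝟙 (toℕ (π i) <ᵇ toℕ i)) (allFin n) ⟩
    sum (map (λ i → 𝟙 (toℕ i <ᵇ toℕ (π i)) * 𝟙 (toℕ (π i) <ᵇ toℕ i)) (allFin n))
      ≡⟨ sum-allFin _ (λ x → 𝟙 (opener x) * 𝟙 (p x <ᵇ x))
           (λ i → cong (λ y → 𝟙 (toℕ i <ᵇ y) * 𝟙 (y <ᵇ toℕ i)) (sym (p-toℕ i))) ⟩
    ∑< n (λ x → 𝟙 (opener x) * 𝟙 (p x <ᵇ x))
      ≡⟨ trans (∑<-cong n (λ x _ → opener-block x)) (∑<-zero n) ⟩
    0 ∎
    where open ≡-Reasoning

  openers-pairs : pairSum openers (λ i j → blockInversions (toℕ i) (toℕ (π i)) (toℕ j) (toℕ (π j)))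
                    ≡ #pairs crossing + #pairs nesting
  openers-pairs = begin
    pairSum openers Q
      ≡⟨ pairSum-filter opener? (allFin n) Q ⟩
    pairSum (allFin n) Q′
      ≡⟨ pairSum-tabulate n (λ i → i) Q′ ⟩
    FinSum.sum (λ i → FinSum.sum (λ j → 𝟙 (toℕ i <ᵇ toℕ j) * Q′ i j))
      ≡⟨ FinSum.sum-cong-≗ {n} (λ i → FinSum.sum-cong-≗ {n} (λ j → arcs i j)) ⟩
    ∑∑ (λ a c → 𝟙 (crossing a c) + 𝟙 (nesting a c))
      ≡⟨ ∑∑-+ (λ a c → 𝟙 (crossing a c)) (λ a c → 𝟙 (nesting a c)) ⟩
    #pairs crossing + #pairs nesting ∎
    where
      open ≡-Reasoning
      Q Q′ : Fin n → Fin n → ℕ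
      Q  i j = blockInversions (toℕ i) (toℕ (π i)) (toℕ j) (toℕ (π j))
      Q′ i j = 𝟙 (does (opener? i)) * (𝟙 (does (opener? j)) * Q i j)
      arcs : ∀ i j → 𝟙 (toℕ i <ᵇ toℕ j) * Q′ i j ≡ 𝟙 (crossing (toℕ i) (toℕ j)) + 𝟙 (nesting (toℕ i) (toℕ j))
      arcs i j = trans
        (cong₂ (λ u v → 𝟙 (toℕ i <ᵇ toℕ j)
                          * (𝟙 (toℕ i <ᵇ u) * (𝟙 (toℕ j <ᵇ v) * blockInversions (toℕ i) u (toℕ j) v)))
               (sym (p-toℕ i)) (sym (p-toℕ j)))
        (arcInversions (toℕ i) (toℕ j))

  𝔍-pairs : 𝔍 π ≡ #pairs crossing + #pairs nesting
  𝔍-pairs = trans (inversions-blockWord toℕ (toℕ ∘ π) openers)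
                  (cong₂ _+_ openers-not-inverted openers-pairs)

  fixedSum-pairs : fixedSum π ≡ #pairs fixedLeft
  fixedSum-pairs = begin
    fixedSum π
      ≡⟨ sum-filter (λ i → toℕ (π i) ≟ toℕ i) (λ i → n ∸ suc (toℕ i)) (allFin n) ⟩
    sum (map (λ i → 𝟙 (toℕ (π i) ≡ᵇ toℕ i) * (n ∸ suc (toℕ i))) (allFin n))
      ≡⟨ sum-allFin _ (λ a → 𝟙 (fixed a) * (n ∸ suc a))
           (λ i → cong (λ y → 𝟙 (y ≡ᵇ toℕ i) * (n ∸ suc (toℕ i))) (sym (p-toℕ i))) ⟩
    ∑< n (λ a → 𝟙 (fixed a) * (n ∸ suc a))
      ≡⟨ ∑<-cong n (λ a _ → sym (fixedLeft-row a)) ⟩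
    #pairs fixedLeft ∎
    where open ≡-Reasoning

proposition6p2 : (n : ℕ) (π : Fin n → Fin n) → IsInvolution π →
    𝔄 π ≡ 𝔍 π + fixedSum π
proposition6p2 n π π-inv = begin
  𝔄 π                                                    ≡⟨ 𝔄-pairs ⟩
  #pairs unchanged                                       ≡⟨ #unchanged ⟩
  #pairs fixedLeft + (#pairs crossing + #pairs nesting)  ≡⟨ cong₂ _+_ (sym fixedSum-pairs) (sym 𝔍-pairs) ⟩
  fixedSum π + 𝔍 π                                       ≡⟨ +-comm (fixedSum π) (𝔍 π) ⟩
  𝔍 π + fixedSum π                                       ∎
  where
    open ≡-Reasoning
    open FinInvolution π π-inv
    open ArcCounting n p p-inv p-bound
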